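{- Let $m\ge 3$ be even and $n\ge2$. Suppose $\mathcal{A},\mathcal{B}$ are symmetric $Z$-tensors of order $m$ and dimension $n$. If $\mathcal{A}\le\mathcal{B}$ (entrywise) and $\mathcal{A}$ is positive semi-definite, then $\mathcal{B}$ is positive semi-definite.
   Context: A tensor $\mathcal{A}=(a_{i_1\cdots i_m})$ is a $Z$-tensor if all its off-diagonal entries are nonpositive, i.e. $a_{i_1\cdots i_m}\le0$ unless $i_1=\cdots=i_m$. $\mathcal{A}\le\mathcal{B}$ means $a_{i_1\cdots i_m}\le b_{i_1\cdots i_m}$ for all indices. An even order symmetric tensor $\mathcal{A}$ is positive semi-definite if $\mathcal{A}\mathbf{x}^m=\sum_{i_1,\dots,i_m}a_{i_1\cdots i_m}x_{i_1}\cdots x_{i_m}\ge0$ for all $\mathbf{x}\in\mathbb{R}^n$. -}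

module Defs where

open import Level using (0ℓ)
open import Data.Nat using (ℕ; zero; suc)
open import Data.Fin using (Fin; zero; suc)
open import Data.Fin.Permutation using (Permutation′; _⟨$⟩ʳ_)
open import Data.Product using (Σ; _×_)
open import Relation.Nullary using (¬_)
open import Relation.Binary.PropositionalEquality using (_≡_)
open import Relation.Binary.Structures using (IsTotalOrder)
open import Algebra.Bundles using (CommutativeRing)
open import Function using (_∘_)
import Data.Vec.Functional as VF

-- The real numbers, axiomatised as a complete (Dedekind / least-upper-bound)
-- ordered field.  Every model is isomorphic to ℝ.
record Reals : Set₁ where
  field
    commRing : CommutativeRing 0ℓ 0ℓ
  open CommutativeRing commRing public
  infix 4 _≤_
  field
    _≤_          : Carrier → Carrier → Set
    isTotalOrder : IsTotalOrder _≈_ _≤_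
    +-mono-≤     : ∀ {x y} z → x ≤ y → x + z ≤ y + z
    *-nonneg     : ∀ {x y} → 0# ≤ x → 0# ≤ y → 0# ≤ x * y
    0≉1          : ¬ (0# ≈ 1#)
    inverse      : ∀ x → ¬ (x ≈ 0#) → Σ Carrier (λ y → x * y ≈ 1#)
    lub          : (P : Carrier → Set) → Σ Carrier P →
                   Σ Carrier (λ b → ∀ x → P x → x ≤ b) →
                   Σ Carrier (λ s → (∀ x → P x → x ≤ s) ×
                                    (∀ b → (∀ x → P x → x ≤ b) → s ≤ b))

module _ (R : Reals) where
  open Reals R using (Carrier; _≈_; _+_; _*_; 0#; 1#; _≤_)

  Tensor : ℕ → ℕ → Set
  Tensor m n = (Fin m → Fin n) → Carrier

  sumFin : ∀ n → (Fin n → Carrier) → Carrier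
  sumFin zero    f = 0#
  sumFin (suc n) f = f zero + sumFin n (f ∘ suc)

  prodFin : ∀ m → (Fin m → Carrier) → Carrier
  prodFin zero    f = 1#
  prodFin (suc m) f = f zero * prodFin m (f ∘ suc)

  sumIdx : ∀ m n → ((Fin m → Fin n) → Carrier) → Carrier
  sumIdx zero    n f = f (λ ())
  sumIdx (suc m) n f = sumFin n (λ i → sumIdx m n (λ ι → f (i VF.∷ ι)))

  apply : ∀ {m n} → Tensor m n → (Fin n → Carrier) → Carrier
  apply {m} {n} A x = sumIdx m n (λ ι → A ι * prodFin m (λ k → x (ι k)))

  Symmetric : ∀ {m n} → Tensor m n → Set
  Symmetric {m} A = ∀ (σ : Permutation′ m) ι → A (ι ∘ (σ ⟨$⟩ʳ_)) ≈ A ι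

  Diagonal : ∀ {m n} → (Fin m → Fin n) → Set
  Diagonal ι = ∀ k l → ι k ≡ ι l

  ZTensor : ∀ {m n} → Tensor m n → Set
  ZTensor A = ∀ ι → ¬ Diagonal ι → A ι ≤ 0#

  _≤ᵀ_ : ∀ {m n} → Tensor m n → Tensor m n → Set
  A ≤ᵀ B = ∀ ι → A ι ≤ B ι

  PSD : ∀ {m n} → Tensor m n → Set
  PSD {n = n} A = ∀ (x : Fin n → Carrier) → 0# ≤ apply A x

-- Replace x by y = |x|.  Every monomial y_{i₁}⋯y_{iₘ} is nonnegative and
-- dominates x_{i₁}⋯x_{iₘ}, with equality on the diagonal because m is even.
-- Hence on the diagonal a ι y^ι ≤ b ι x^ι by 𝒜 ≤ ℬ, and off the diagonal
-- a ι y^ι ≤ b ι y^ι ≤ b ι x^ι because b ι ≤ 0.  Summing, 0 ≤ 𝒜 y^m ≤ ℬ x^m.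
module Submission where

open import Defs
open import Data.Nat using (ℕ)
import Data.Nat as ℕ
open import Data.Nat.Divisibility using (_∣_; divides)
open import Data.Fin using (Fin; zero; suc)
open import Data.Fin.Properties using (all?; _≟_)
open import Data.Sum using (_⊎_; inj₁; inj₂)
open import Relation.Nullary using (Dec; yes; no)
open import Relation.Binary.Bundles using (Poset)
open import Relation.Binary.Structures using (IsTotalOrder)
import Relation.Binary.PropositionalEquality as ≡
open import Function using (_∘_)

module OrderedRingProperties (R : Reals) where
  open Reals R hiding (zero) renaming (+-mono-≤ to +-monoˡ-≤)
  open import Algebra.Properties.Ring ring
    using (-0#≈0#; -‿involutive; -‿distribˡ-*; -‿distribʳ-*)
  open IsTotalOrder isTotalOrder using (total; isPartialOrder)
    renaming (refl to ≤-refl; reflexive to ≤-reflexive)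

  poset : Poset _ _ _
  poset = record { isPartialOrder = isPartialOrder }

  open import Relation.Binary.Reasoning.PartialOrder poset

  x+[-x+y]≈y : ∀ x y → x + (- x + y) ≈ y
  x+[-x+y]≈y x y = begin-equality
    x + (- x + y)   ≈⟨ +-assoc x (- x) y ⟨
    (x + - x) + y   ≈⟨ +-congʳ (-‿inverseʳ x) ⟩
    0# + y          ≈⟨ +-identityˡ y ⟩
    y               ∎

  +-mono-≤ : ∀ {a b c d} → a ≤ b → c ≤ d → a + c ≤ b + d
  +-mono-≤ {a} {b} {c} {d} a≤b c≤d = begin
    a + c   ≤⟨ +-monoˡ-≤ c a≤b ⟩
    b + c   ≈⟨ +-comm b c ⟩
    c + b   ≤⟨ +-monoˡ-≤ b c≤d ⟩
    d + b   ≈⟨ +-comm d b ⟩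
    b + d   ∎

  neg-antimono-≤ : ∀ {x y} → x ≤ y → - y ≤ - x
  neg-antimono-≤ {x} {y} x≤y = begin
    - y               ≈⟨ x+[-x+y]≈y x (- y) ⟨
    x + (- x + - y)   ≤⟨ +-monoˡ-≤ (- x + - y) x≤y ⟩
    y + (- x + - y)   ≈⟨ +-congˡ (+-comm (- x) (- y)) ⟩
    y + (- y + - x)   ≈⟨ x+[-x+y]≈y y (- x) ⟩
    - x               ∎

  nonPos⇒neg-nonNeg : ∀ {x} → x ≤ 0# → 0# ≤ - x
  nonPos⇒neg-nonNeg x≤0 = begin
    0#     ≈⟨ -0#≈0# ⟨
    - 0#   ≤⟨ neg-antimono-≤ x≤0 ⟩
    - _    ∎

  nonNeg⇒neg-nonPos : ∀ {x} → 0# ≤ x → - x ≤ 0#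
  nonNeg⇒neg-nonPos 0≤x = begin
    - _    ≤⟨ neg-antimono-≤ 0≤x ⟩
    - 0#   ≈⟨ -0#≈0# ⟩
    0#     ∎

  -x*-y≈x*y : ∀ x y → - x * - y ≈ x * y
  -x*-y≈x*y x y = begin-equality
    - x * - y       ≈⟨ -‿distribˡ-* x (- y) ⟨
    - (x * - y)     ≈⟨ -‿cong (-‿distribʳ-* x y) ⟨
    - - (x * y)     ≈⟨ -‿involutive (x * y) ⟩
    x * y           ∎

  *-monoˡ-≤-nonNeg : ∀ {x y z} → 0# ≤ z → x ≤ y → x * z ≤ y * z
  *-monoˡ-≤-nonNeg {x} {y} {z} 0≤z x≤y = begin
    x * z                  ≈⟨ +-identityˡ (x * z) ⟨
    0# + x * z             ≤⟨ +-monoˡ-≤ (x * z) (*-nonneg 0≤-x+y 0≤z) ⟩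
    (- x + y) * z + x * z  ≈⟨ distribʳ z (- x + y) x ⟨
    ((- x + y) + x) * z    ≈⟨ *-congʳ (+-comm (- x + y) x) ⟩
    (x + (- x + y)) * z    ≈⟨ *-congʳ (x+[-x+y]≈y x y) ⟩
    y * z                  ∎
    where
    0≤-x+y : 0# ≤ - x + y
    0≤-x+y = begin
      0#       ≈⟨ -‿inverseˡ x ⟨
      - x + x  ≈⟨ +-comm (- x) x ⟩
      x + - x  ≤⟨ +-monoˡ-≤ (- x) x≤y ⟩
      y + - x  ≈⟨ +-comm y (- x) ⟩
      - x + y  ∎

  *-monoʳ-≤-nonPos : ∀ {x y z} → z ≤ 0# → x ≤ y → z * y ≤ z * x
  *-monoʳ-≤-nonPos {x} {y} {z} z≤0 x≤y = begin
    z * y          ≈⟨ z*w≈-[w*-z] y ⟩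
    - (y * - z)    ≤⟨ neg-antimono-≤ (*-monoˡ-≤-nonNeg (nonPos⇒neg-nonNeg z≤0) x≤y) ⟩
    - (x * - z)    ≈⟨ z*w≈-[w*-z] x ⟨
    z * x          ∎
    where
    z*w≈-[w*-z] : ∀ w → z * w ≈ - (w * - z)
    z*w≈-[w*-z] w = begin-equality
      z * w          ≈⟨ *-comm z w ⟩
      w * z          ≈⟨ -‿involutive (w * z) ⟨
      - - (w * z)    ≈⟨ -‿cong (-‿distribʳ-* w z) ⟩
      - (w * - z)    ∎

  x*x-nonNeg : ∀ x → 0# ≤ x * x
  x*x-nonNeg x with total 0# x
  ... | inj₁ 0≤x = *-nonneg 0≤x 0≤x
  ... | inj₂ x≤0 = begin
    0#          ≤⟨ *-nonneg (nonPos⇒neg-nonNeg x≤0) (nonPos⇒neg-nonNeg x≤0) ⟩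
    - x * - x   ≈⟨ -x*-y≈x*y x x ⟩
    x * x       ∎

  0≤1 : 0# ≤ 1#
  0≤1 = begin
    0#        ≤⟨ x*x-nonNeg 1# ⟩
    1# * 1#   ≈⟨ *-identityˡ 1# ⟩
    1#        ∎

  infix 4 _≈±_
  _≈±_ : Carrier → Carrier → Set
  x ≈± y = x ≈ y ⊎ x ≈ - y

  *-cong-≈± : ∀ {x y u v} → x ≈± y → u ≈± v → x * u ≈± y * v
  *-cong-≈± (inj₁ x≈y)  (inj₁ u≈v)  = inj₁ (*-cong x≈y u≈v)
  *-cong-≈± {y = y} {v = v} (inj₁ x≈y) (inj₂ u≈-v) =
    inj₂ (trans (*-cong x≈y u≈-v) (sym (-‿distribʳ-* y v)))
  *-cong-≈± {y = y} {v = v} (inj₂ x≈-y) (inj₁ u≈v) =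
    inj₂ (trans (*-cong x≈-y u≈v) (sym (-‿distribˡ-* y v)))
  *-cong-≈± {y = y} {v = v} (inj₂ x≈-y) (inj₂ u≈-v) =
    inj₁ (trans (*-cong x≈-y u≈-v) (-x*-y≈x*y y v))

  ≈±⇒x*x≈y*y : ∀ {x y} → x ≈± y → x * x ≈ y * y
  ≈±⇒x*x≈y*y (inj₁ x≈y)  = *-cong x≈y x≈y
  ≈±⇒x*x≈y*y {y = y} (inj₂ x≈-y) = trans (*-cong x≈-y x≈-y) (-x*-y≈x*y y y)

  ≈±⇒≤-nonNeg : ∀ {x y} → x ≈± y → 0# ≤ y → x ≤ y
  ≈±⇒≤-nonNeg (inj₁ x≈y) 0≤y = ≤-reflexive x≈y
  ≈±⇒≤-nonNeg {x} {y} (inj₂ x≈-y) 0≤y = begin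
    x     ≈⟨ x≈-y ⟩
    - y   ≤⟨ nonNeg⇒neg-nonPos 0≤y ⟩
    0#    ≤⟨ 0≤y ⟩
    y     ∎

  ∣_∣ : Carrier → Carrier
  ∣ x ∣ with total 0# x
  ... | inj₁ _ = x
  ... | inj₂ _ = - x

  ∣x∣-nonNeg : ∀ x → 0# ≤ ∣ x ∣
  ∣x∣-nonNeg x with total 0# x
  ... | inj₁ 0≤x = 0≤x
  ... | inj₂ x≤0 = nonPos⇒neg-nonNeg x≤0

  x≈±∣x∣ : ∀ x → x ≈± ∣ x ∣
  x≈±∣x∣ x with total 0# x
  ... | inj₁ _ = inj₁ refl
  ... | inj₂ _ = inj₂ (sym (-‿involutive x))

  sumFin-mono-≤ : ∀ n {f g : Fin n → Carrier} → (∀ i → f i ≤ g i) →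
                  sumFin R n f ≤ sumFin R n g
  sumFin-mono-≤ ℕ.zero    f≤g = ≤-refl
  sumFin-mono-≤ (ℕ.suc n) f≤g = +-mono-≤ (f≤g zero) (sumFin-mono-≤ n (f≤g ∘ suc))

  sumIdx-mono-≤ : ∀ m n {f g : (Fin m → Fin n) → Carrier} → (∀ ι → f ι ≤ g ι) →
                  sumIdx R m n f ≤ sumIdx R m n g
  sumIdx-mono-≤ ℕ.zero    n f≤g = f≤g _
  sumIdx-mono-≤ (ℕ.suc m) n f≤g = sumFin-mono-≤ n (λ i → sumIdx-mono-≤ m n (λ ι → f≤g _))

  prodFin-nonNeg : ∀ m {f : Fin m → Carrier} → (∀ k → 0# ≤ f k) → 0# ≤ prodFin R m f
  prodFin-nonNeg ℕ.zero    0≤f = 0≤1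
  prodFin-nonNeg (ℕ.suc m) 0≤f = *-nonneg (0≤f zero) (prodFin-nonNeg m (0≤f ∘ suc))

  prodFin-≈± : ∀ m {f g : Fin m → Carrier} → (∀ k → f k ≈± g k) →
               prodFin R m f ≈± prodFin R m g
  prodFin-≈± ℕ.zero    f≈±g = inj₁ refl
  prodFin-≈± (ℕ.suc m) f≈±g = *-cong-≈± (f≈±g zero) (prodFin-≈± m (f≈±g ∘ suc))

  Constant : ∀ {m} → (Fin m → Carrier) → Set
  Constant f = ∀ k l → f k ≈ f l

  prodFin-even-≈ : ∀ q {f g : Fin (q ℕ.* 2) → Carrier} → Constant f → Constant g →
                   (∀ k → f k ≈± g k) → prodFin R (q ℕ.* 2) f ≈ prodFin R (q ℕ.* 2) g
  prodFin-even-≈ ℕ.zero    _      _      _    = refl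
  prodFin-even-≈ (ℕ.suc q) {f} {g} f-const g-const f≈±g = begin-equality
    f zero * (f (suc zero) * P)   ≈⟨ *-congˡ (*-congʳ (f-const (suc zero) zero)) ⟩
    f zero * (f zero * P)         ≈⟨ *-assoc (f zero) (f zero) P ⟨
    (f zero * f zero) * P         ≈⟨ *-cong (≈±⇒x*x≈y*y (f≈±g zero)) P≈Q ⟩
    (g zero * g zero) * Q         ≈⟨ *-assoc (g zero) (g zero) Q ⟩
    g zero * (g zero * Q)         ≈⟨ *-congˡ (*-congʳ (g-const zero (suc zero))) ⟩
    g zero * (g (suc zero) * Q)   ∎
    where
    P = prodFin R (q ℕ.* 2) (f ∘ suc ∘ suc)
    Q = prodFin R (q ℕ.* 2) (g ∘ suc ∘ suc)
    P≈Q : P ≈ Q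
    P≈Q = prodFin-even-≈ q (λ k l → f-const (suc (suc k)) (suc (suc l)))
                           (λ k l → g-const (suc (suc k)) (suc (suc l)))
                           (f≈±g ∘ suc ∘ suc)

module _ (R : Reals) where
  open Reals R using (Carrier; _≈_; _*_; 0#; _≤_; *-congˡ; reflexive)
  open OrderedRingProperties R
  open import Relation.Binary.Reasoning.PartialOrder poset

  diagonal? : ∀ {m n} (ι : Fin m → Fin n) → Dec (Diagonal R ι)
  diagonal? {ℕ.zero}  ι = yes (λ ())
  diagonal? {ℕ.suc m} ι with all? (λ k → ι k ≟ ι zero)
  ... | yes ι≡ι₀ = yes (λ k l → ≡.trans (ι≡ι₀ k) (≡.sym (ι≡ι₀ l)))
  ... | no ¬ι≡ι₀ = no (λ diag → ¬ι≡ι₀ (λ k → diag k zero))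

  monomial : ∀ {m n} → (Fin m → Fin n) → (Fin n → Carrier) → Carrier
  monomial {m} ι x = prodFin R m (x ∘ ι)

  monomial-∣∣-nonNeg : ∀ {m n} (ι : Fin m → Fin n) x → 0# ≤ monomial ι (∣_∣ ∘ x)
  monomial-∣∣-nonNeg {m} ι x = prodFin-nonNeg m (∣x∣-nonNeg ∘ x ∘ ι)

  monomial-≤-∣∣ : ∀ {m n} (ι : Fin m → Fin n) x → monomial ι x ≤ monomial ι (∣_∣ ∘ x)
  monomial-≤-∣∣ {m} ι x =
    ≈±⇒≤-nonNeg (prodFin-≈± m (x≈±∣x∣ ∘ x ∘ ι)) (monomial-∣∣-nonNeg ι x)

  monomial-even-diagonal-∣∣ : ∀ q {n} (ι : Fin (q ℕ.* 2) → Fin n) x → Diagonal R ι →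
                              monomial ι x ≈ monomial ι (∣_∣ ∘ x)
  monomial-even-diagonal-∣∣ q ι x diag =
    prodFin-even-≈ q (λ k l → reflexive (≡.cong x (diag k l)))
                     (λ k l → reflexive (≡.cong (∣_∣ ∘ x) (diag k l)))
                     (x≈±∣x∣ ∘ x ∘ ι)

  apply-∣∣-≤ : ∀ q {n} (A B : Tensor R (q ℕ.* 2) n) → ZTensor R B → _≤ᵀ_ R A B →
               ∀ x → apply R A (∣_∣ ∘ x) ≤ apply R B x
  apply-∣∣-≤ q {n} A B ZB A≤B x = sumIdx-mono-≤ (q ℕ.* 2) n term-≤
    where
    term-≤ : ∀ ι → A ι * monomial ι (∣_∣ ∘ x) ≤ B ι * monomial ι x
    term-≤ ι with diagonal? ι
    ... | yes diag = begin
      A ι * monomial ι (∣_∣ ∘ x)   ≤⟨ *-monoˡ-≤-nonNeg (monomial-∣∣-nonNeg ι x) (A≤B ι) ⟩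
      B ι * monomial ι (∣_∣ ∘ x)   ≈⟨ *-congˡ (monomial-even-diagonal-∣∣ q ι x diag) ⟨
      B ι * monomial ι x           ∎
    ... | no ¬diag = begin
      A ι * monomial ι (∣_∣ ∘ x)   ≤⟨ *-monoˡ-≤-nonNeg (monomial-∣∣-nonNeg ι x) (A≤B ι) ⟩
      B ι * monomial ι (∣_∣ ∘ x)   ≤⟨ *-monoʳ-≤-nonPos (ZB ι ¬diag) (monomial-≤-∣∣ ι x) ⟩
      B ι * monomial ι x           ∎

open import Data.Nat using (_≤_)

lemma4p2 : (R : Reals) (m n : ℕ) → 3 ≤ m → 2 ∣ m → 2 ≤ n →
           (A B : Tensor R m n) →
           Symmetric R A → Symmetric R B → ZTensor R A → ZTensor R B →
           _≤ᵀ_ R A B → PSD R A → PSD R B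
lemma4p2 R .(q ℕ.* 2) n _ (divides q ≡.refl) _ A B _ _ _ ZB A≤B psdA x =
  trans (psdA (∣_∣ ∘ x)) (apply-∣∣-≤ R q A B ZB A≤B x)
  where
  open Reals R using (isTotalOrder)
  open IsTotalOrder isTotalOrder using (trans)
  open OrderedRingProperties R using (∣_∣)
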